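{- Let $\mathbf{A}$ be a distributive nearlattice. If $\mathbf{A}$ is Stone, then $\mathbf{A}$ is normal.
   Context: A distributive nearlattice is a join-semilattice $\langle A,\vee,1\rangle$ with greatest element $1$ in which every principal filter $[a)=\{x\in A\colon a\le x\}$ is a bounded distributive lattice. A filter of $A$ is a subset containing $1$, upward closed, and closed under those binary meets that exist; for filters $F,G$, $F\veebar G$ is the smallest filter containing $F\cup G$. For $a\in A$, $a^{\top}=\{x\in A\colon x\vee a=1\}$ and $a^{\top\top}=\{y\in A\colon y\vee x=1\text{ for all }x\in a^{\top}\}$. $\mathbf{A}$ is Stone if $a^{\top}\veebar a^{\top\top}=A$ for every $a\in A$. An ideal is a downward closed, $\vee$-closed subset; a prime ideal is a non-empty proper ideal $P$ with $a\wedge b\in P\Rightarrow a\in P$ or $b\in P$ whenever $a\wedge b$ exists; a maximal ideal is a non-empty proper ideal not properly contained in any proper ideal. $\mathbf{A}$ is normal if each prime ideal is contained in a unique maximal ideal. -}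

module Defs where

open import Level using (Level; _⊔_) renaming (suc to lsuc)
open import Data.Product using (Σ; ∃; _×_; _,_)
open import Data.Sum using (_⊎_)
open import Relation.Nullary using (¬_)
open import Relation.Binary.PropositionalEquality using (_≡_)

record JoinSemilatticeTop (ℓ : Level) : Set (lsuc ℓ) where
  infixr 6 _∨_
  field
    Carrier : Set ℓ
    _∨_     : Carrier → Carrier → Carrier
    𝟙       : Carrier
    ∨-assoc : ∀ x y z → (x ∨ y) ∨ z ≡ x ∨ (y ∨ z)
    ∨-comm  : ∀ x y → x ∨ y ≡ y ∨ x
    ∨-idem  : ∀ x → x ∨ x ≡ x
    ∨-top   : ∀ x → x ∨ 𝟙 ≡ 𝟙

  infix 4 _≤_
  _≤_ : Carrier → Carrier → Set ℓ
  x ≤ y = x ∨ y ≡ y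

  IsMeet : Carrier → Carrier → Carrier → Set ℓ
  IsMeet x y m = (m ≤ x) × (m ≤ y) × (∀ z → z ≤ x → z ≤ y → z ≤ m)

-- A distributive nearlattice: every principal filter [a) = {x | a ≤ x}, with the
-- induced order, is a bounded distributive lattice (bottom a, top 1; joins are
-- those of A, since [a) is closed under ∨).  We record the meet operation of
-- each [a) as the greatest lower bound inside [a), and distributivity in [a).
record DistributiveNearlattice (ℓ : Level) : Set (lsuc ℓ) where
  field
    semilattice : JoinSemilatticeTop ℓ
  open JoinSemilatticeTop semilattice public
  field
    meetₐ     : ∀ a x y → a ≤ x → a ≤ y → Carrier
    meetₐ-≥a  : ∀ a x y (p : a ≤ x) (q : a ≤ y) → a ≤ meetₐ a x y p q
    meetₐ-≤ˡ  : ∀ a x y (p : a ≤ x) (q : a ≤ y) → meetₐ a x y p q ≤ x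
    meetₐ-≤ʳ  : ∀ a x y (p : a ≤ x) (q : a ≤ y) → meetₐ a x y p q ≤ y
    meetₐ-glb : ∀ a x y (p : a ≤ x) (q : a ≤ y) → ∀ z → a ≤ z → z ≤ x → z ≤ y →
                z ≤ meetₐ a x y p q
    meetₐ-distrib : ∀ a x y z (p : a ≤ x) (q : a ≤ y) (r : a ≤ z) (qr : a ≤ y ∨ z) →
                meetₐ a x (y ∨ z) p qr ≡ meetₐ a x y p q ∨ meetₐ a x z p r

module _ {ℓ : Level} (𝐀 : DistributiveNearlattice ℓ) where
  open DistributiveNearlattice 𝐀

  Subset : Set (lsuc ℓ)
  Subset = Carrier → Set ℓ

  _⊆_ : Subset → Subset → Set ℓ
  S ⊆ T = ∀ x → S x → T x

  IsFilter : Subset → Set ℓ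
  IsFilter F = F 𝟙 × (∀ x y → x ≤ y → F x → F y)
             × (∀ x y m → IsMeet x y m → F x → F y → F m)

  _⊻_ : Subset → Subset → Carrier → Set (lsuc ℓ)
  (F ⊻ G) x = ∀ (H : Subset) → IsFilter H → F ⊆ H → G ⊆ H → H x

  _ᵀ : Carrier → Subset
  (a ᵀ) x = x ∨ a ≡ 𝟙

  _ᵀᵀ : Carrier → Subset
  (a ᵀᵀ) y = ∀ x → (a ᵀ) x → y ∨ x ≡ 𝟙

  IsStone : Set (lsuc ℓ)
  IsStone = ∀ a x → ((a ᵀ) ⊻ (a ᵀᵀ)) x

  IsIdeal : Subset → Set ℓ
  IsIdeal I = (∀ x y → x ≤ y → I y → I x) × (∀ x y → I x → I y → I (x ∨ y))

  IsProperIdeal : Subset → Set ℓ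
  IsProperIdeal I = IsIdeal I × (∃ λ x → ¬ I x)

  IsPrimeIdeal : Subset → Set ℓ
  IsPrimeIdeal P = IsIdeal P × (∃ λ x → P x) × (∃ λ x → ¬ P x)
                 × (∀ a b m → IsMeet a b m → P m → P a ⊎ P b)

  IsMaximalIdeal : Subset → Set (lsuc ℓ)
  IsMaximalIdeal M = IsIdeal M × (∃ λ x → M x) × (∃ λ x → ¬ M x)
                   × (∀ (J : Subset) → IsProperIdeal J → M ⊆ J → J ⊆ M)

  IsNormal : Set (lsuc ℓ)
  IsNormal = ∀ (P : Subset) → IsPrimeIdeal P →
             Σ Subset λ M → IsMaximalIdeal M × P ⊆ M ×
               (∀ (M′ : Subset) → IsMaximalIdeal M′ → P ⊆ M′ → M′ ⊆ M × M ⊆ M′)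

module Submission where

open import Level using (Level)
open import Defs
open import Algebra.Bundles using (CommutativeSemigroup)
import Algebra.Properties.CommutativeSemigroup as CommutativeSemigroupProperties
open import Data.Product using (_×_; _,_)
open import Data.Sum using ([_,_])
open import Relation.Nullary using (¬_)
open import Relation.Unary using (∁)
open import Relation.Binary.PropositionalEquality using (_≡_; sym; trans; cong; cong₂; subst; isEquivalence; module ≡-Reasoning)

-- For a prime ideal P let M be the set of x with x ∨ p ≠ 1 for all
-- p ∈ P.  Every proper ideal containing P lies inside M, so M is the unique
-- maximal ideal above P as soon as it is an ideal; only closure under ∨ is not
-- automatic.  The complement of P is a filter, and the Stone property says that
-- no filter can contain both xᵀ and xᵀᵀ unless it is everything; if x, z ∈ M
-- and (x ∨ z) ∨ p = 1 with p ∈ P, then both xᵀ and xᵀᵀ avoid P.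

module JoinSemilatticeTopProperties {ℓ : Level} (L : JoinSemilatticeTop ℓ) where
  open JoinSemilatticeTop L

  ∨-commutativeSemigroup : CommutativeSemigroup ℓ ℓ
  ∨-commutativeSemigroup = record
    { _≈_ = _≡_
    ; _∙_ = _∨_
    ; isCommutativeSemigroup = record
      { isSemigroup = record
        { isMagma = record { isEquivalence = isEquivalence ; ∙-cong = cong₂ _∨_ }
        ; assoc   = ∨-assoc
        }
      ; comm = ∨-comm
      }
    }

  open CommutativeSemigroupProperties ∨-commutativeSemigroup public

  ∨-zeroˡ : ∀ x → 𝟙 ∨ x ≡ 𝟙
  ∨-zeroˡ x = trans (∨-comm 𝟙 x) (∨-top x)

  ∨≡𝟙-monoˡ : ∀ {x y z} → x ≤ y → x ∨ z ≡ 𝟙 → y ∨ z ≡ 𝟙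
  ∨≡𝟙-monoˡ {x} {y} {z} x≤y x∨z≡𝟙 = begin
    y ∨ z        ≡⟨ cong (_∨ z) (sym x≤y) ⟩
    (x ∨ y) ∨ z  ≡⟨ xy∙z≈y∙xz x y z ⟩
    y ∨ (x ∨ z)  ≡⟨ cong (y ∨_) x∨z≡𝟙 ⟩
    y ∨ 𝟙        ≡⟨ ∨-top y ⟩
    𝟙            ∎
    where open ≡-Reasoning

module _ {ℓ : Level} (𝐀 : DistributiveNearlattice ℓ) where
  open DistributiveNearlattice 𝐀
  open JoinSemilatticeTopProperties semilattice

  properIdeal-∌𝟙 : ∀ {J} → IsProperIdeal 𝐀 J → ¬ J 𝟙
  properIdeal-∌𝟙 ((J-down , _) , (w , w∉J)) 𝟙∈J = w∉J (J-down w 𝟙 (∨-top w) 𝟙∈J)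

  primeIdeal⇒properIdeal : ∀ {P} → IsPrimeIdeal 𝐀 P → IsProperIdeal 𝐀 P
  primeIdeal⇒properIdeal (P-ideal , _ , P-proper , _) = P-ideal , P-proper

  maximalIdeal⇒properIdeal : ∀ {M} → IsMaximalIdeal 𝐀 M → IsProperIdeal 𝐀 M
  maximalIdeal⇒properIdeal (M-ideal , _ , M-proper , _) = M-ideal , M-proper

  ∁primeIdeal-isFilter : ∀ {P} → IsPrimeIdeal 𝐀 P → IsFilter 𝐀 (∁ P)
  ∁primeIdeal-isFilter P-prime@((P-down , _) , _ , _ , P-prime-meet) =
      properIdeal-∌𝟙 (primeIdeal⇒properIdeal P-prime)
    , (λ x y x≤y x∉P y∈P → x∉P (P-down x y x≤y y∈P))
    , (λ x y m m≡x∧y x∉P y∉P m∈P → [ x∉P , y∉P ] (P-prime-meet x y m m≡x∧y m∈P))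

  stone-∁primeIdeal : IsStone 𝐀 → ∀ {P} → IsPrimeIdeal 𝐀 P →
                      ∀ a → _⊆_ 𝐀 (_ᵀ 𝐀 a) (∁ P) → ¬ _⊆_ 𝐀 (_ᵀᵀ 𝐀 a) (∁ P)
  stone-∁primeIdeal stone P-prime@(_ , (p , p∈P) , _) a aᵀ⊆∁P aᵀᵀ⊆∁P =
    stone a p (∁ _) (∁primeIdeal-isFilter P-prime) aᵀ⊆∁P aᵀᵀ⊆∁P p∈P

  maximalOver : Subset 𝐀 → Subset 𝐀
  maximalOver P x = ∀ p → P p → ¬ x ∨ p ≡ 𝟙

  properIdeal⊆maximalOver : ∀ {P J} → IsProperIdeal 𝐀 J → _⊆_ 𝐀 P J →
                            _⊆_ 𝐀 J (maximalOver P)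
  properIdeal⊆maximalOver {J = J} J-proper@((_ , J-join) , _) P⊆J x x∈J p p∈P x∨p≡𝟙 =
    properIdeal-∌𝟙 J-proper (subst J x∨p≡𝟙 (J-join x p x∈J (P⊆J p p∈P)))

  maximalOver-∌𝟙 : ∀ {P p} → P p → ¬ maximalOver P 𝟙
  maximalOver-∌𝟙 {p = p} p∈P 𝟙∈M = 𝟙∈M p p∈P (∨-zeroˡ p)

  maximalOver-down : ∀ P x y → x ≤ y → maximalOver P y → maximalOver P x
  maximalOver-down P x y x≤y y∈M p p∈P x∨p≡𝟙 = y∈M p p∈P (∨≡𝟙-monoˡ x≤y x∨p≡𝟙)

  maximalOver-ᵀ⊆∁ : ∀ {P x} → maximalOver P x → _⊆_ 𝐀 (_ᵀ 𝐀 x) (∁ P)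
  maximalOver-ᵀ⊆∁ {x = x} x∈M y y∨x≡𝟙 y∈P = x∈M y y∈P (trans (∨-comm x y) y∨x≡𝟙)

  maximalOver-join : IsStone 𝐀 → ∀ {P} → IsPrimeIdeal 𝐀 P →
                     ∀ x z → maximalOver P x → maximalOver P z → maximalOver P (x ∨ z)
  maximalOver-join stone {P} P-prime@((_ , P-join) , _) x z x∈M z∈M p p∈P x∨z∨p≡𝟙 =
    stone-∁primeIdeal stone P-prime x (maximalOver-ᵀ⊆∁ x∈M) xᵀᵀ⊆∁P
    where
    z∨p∈xᵀ : _ᵀ 𝐀 x (z ∨ p)
    z∨p∈xᵀ = trans (xy∙z≈zx∙y z p x) x∨z∨p≡𝟙

    -- q ∈ xᵀᵀ ∩ P would give z ∨ (q ∨ p) = q ∨ (z ∨ p) = 1 with q ∨ p ∈ P.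
    xᵀᵀ⊆∁P : _⊆_ 𝐀 (_ᵀᵀ 𝐀 x) (∁ P)
    xᵀᵀ⊆∁P q q∈xᵀᵀ q∈P =
      z∈M (q ∨ p) (P-join q p q∈P p∈P)
        (trans (x∙yz≈y∙xz z q p) (q∈xᵀᵀ (z ∨ p) z∨p∈xᵀ))

theorem4p8 : ∀ {ℓ : Level} (𝐀 : DistributiveNearlattice ℓ) → IsStone 𝐀 → IsNormal 𝐀
theorem4p8 𝐀 stone P P-prime@(_ , (p , p∈P) , _) =
  M , M-maximal , P⊆M , M-unique
  where
  M : Subset 𝐀
  M = maximalOver 𝐀 P

  M-ideal : IsIdeal 𝐀 M
  M-ideal = maximalOver-down 𝐀 P , maximalOver-join 𝐀 stone P-prime

  P⊆M : _⊆_ 𝐀 P M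
  P⊆M = properIdeal⊆maximalOver 𝐀 (primeIdeal⇒properIdeal 𝐀 P-prime) (λ _ x∈P → x∈P)

  M-maximal : IsMaximalIdeal 𝐀 M
  M-maximal = M-ideal , (p , P⊆M p p∈P) , (_ , maximalOver-∌𝟙 𝐀 p∈P)
            , λ J J-proper M⊆J →
                properIdeal⊆maximalOver 𝐀 J-proper (λ x x∈P → M⊆J x (P⊆M x x∈P))

  M-unique : ∀ M′ → IsMaximalIdeal 𝐀 M′ → _⊆_ 𝐀 P M′ → _⊆_ 𝐀 M′ M × _⊆_ 𝐀 M M′
  M-unique M′ M′-maximal@(_ , _ , _ , M′-max) P⊆M′ =
    M′⊆M , M′-max M (M-ideal , (_ , maximalOver-∌𝟙 𝐀 p∈P)) M′⊆M
    where
    M′⊆M : _⊆_ 𝐀 M′ M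
    M′⊆M = properIdeal⊆maximalOver 𝐀 (maximalIdeal⇒properIdeal 𝐀 M′-maximal) P⊆M′
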